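{- Let $F:\mathbb{F}_{2^n}\to\mathbb{F}_{2^n}$. If $S=\{(x,F(x)):x\in\mathbb{F}_{2^n}\}$ is formally self dual under the trace pairing, then so is $\{(x,F^{ -1}(x)):x\in\mathbb{F}_{2^n}\}$, where $F^{ -1}$ denotes the compositional inverse of $F$.
   Context: $\mathrm{Tr}:\mathbb{F}_{2^n}\to\mathbb{F}_2$ is the absolute trace. On the additive group $G=\mathbb{F}_{2^n}^2$, the trace pairing is $\langle (x,y),(a,b)\rangle=(-1)^{\mathrm{Tr}(ax+by)}$. A set $S\subset G$ is formally self dual under the trace pairing if for all $(a,b)\in G$: $\big|\sum_{(x,y)\in S}(-1)^{\mathrm{Tr}(ax+by)}\big|^2=|S|\cdot|\{(s,t)\in S^2:s-t=(a,b)\}|$ (i.e. $S$ and $\Delta(S)$ form a formally dual pair for the isomorphism $\Delta:G\to\hat G$ determined by the pairing). -}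

module Defs where

open import Data.Nat using (ℕ; zero; suc; _^_)
open import Data.Integer using (ℤ; +_; -[1+_]; _*_) renaming (_+_ to _+ℤ_)
open import Data.List using (List; []; _∷_; map; length; concatMap; foldr)
open import Data.Nat.ListAction using (sum)
open import Data.List.Membership.Propositional using (_∈_)
open import Data.List.Relation.Unary.Unique.Propositional using (Unique)
open import Data.Product using (_×_; _,_; ∃)
open import Relation.Binary.PropositionalEquality using (_≡_; _≢_)
open import Relation.Binary.Definitions using (DecidableEquality)
open import Relation.Nullary using (yes; no; _×-dec_)
open import Algebra.Structures using (IsCommutativeRing)

-- A finite field with exactly 2^n elements (hence the field F_{2^n},
-- unique up to isomorphism), with decidable equality and an explicit
-- duplicate-free complete enumeration of its elements.
record GF2^ (n : ℕ) : Set₁ where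
  infixl 6 _+F_
  infixl 7 _*F_
  field
    K     : Set
    _+F_  : K → K → K
    _*F_  : K → K → K
    -F_   : K → K
    0F    : K
    1F    : K
    isCommutativeRing : IsCommutativeRing _≡_ _+F_ _*F_ -F_ 0F 1F
    0≢1   : 0F ≢ 1F
    inverse : ∀ x → x ≢ 0F → ∃ λ y → x *F y ≡ 1F
    _≟_   : DecidableEquality K
    elements : List K
    complete : ∀ x → x ∈ elements
    unique   : Unique elements
    card     : length elements ≡ 2 ^ n

module _ {n : ℕ} (𝔽 : GF2^ n) where
  open GF2^ 𝔽

  powF : K → ℕ → K
  powF x zero    = 1F
  powF x (suc k) = x *F powF x k

  -- absolute trace Tr(x) = Σ_{i<n} x^(2^i)  (lands in the prime field {0,1})
  trF : K → K
  trF x = go n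
    where
    go : ℕ → K
    go zero    = 0F
    go (suc i) = powF x (2 ^ i) +F go i

  sgn : K → ℤ
  sgn z with trF z ≟ 0F
  ... | yes _ = + 1
  ... | no  _ = -[1+ 0 ]

  charSum : List (K × K) → K → K → ℤ
  charSum S a b = foldr _+ℤ_ (+ 0) (map (λ { (x , y) → sgn ((a *F x) +F (b *F y)) }) S)

  diffCount : List (K × K) → K → K → ℕ
  diffCount S a b =
    sum (concatMap (λ { (x , y) → map (λ { (x' , y') → indicator x y x' y' }) S }) S)
    where
    indicator : K → K → K → K → ℕ
    indicator x y x' y' with ((x +F (-F x')) ≟ a) ×-dec ((y +F (-F y')) ≟ b)
    ... | yes _ = 1
    ... | no  _ = 0

  FormallySelfDual : List (K × K) → Set
  FormallySelfDual S = ∀ a b →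
    charSum S a b * charSum S a b ≡ + (length S Data.Nat.* diffCount S a b)

  graph : (K → K) → List (K × K)
  graph F = map (λ x → x , F x) elements

-- Swapping the two coordinates of 𝔽² exchanges the roles of (a,b) and (b,a) in
-- both the character sum and the difference count, so it preserves formal
-- self-duality; both quantities only depend on S as a multiset.  Since F is a
-- bijection, the graph of F⁻¹ is a rearrangement of the swapped graph of F.
module Submission where

open import Defs
open import Data.Nat using (ℕ)
open import Relation.Binary.PropositionalEquality using (_≡_)

open import Algebra.Structures using (IsCommutativeRing)
open import Data.Nat using (_+_)
open import Data.Empty using (⊥-elim)
open import Data.Integer using (ℤ; +_) renaming (_+_ to _+ℤ_)
import Data.Integer.Properties as ℤ
open import Data.List using (List; []; _∷_; map; concatMap; foldr)
open import Data.List.Membership.Propositional using (_∈_)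
open import Data.List.Membership.Propositional.Properties using (∈-map⁺)
open import Data.List.Membership.Propositional.Properties.WithK using (unique∧set⇒bag)
open import Data.List.Properties using (map-cong; map-∘; length-map)
open import Data.List.Relation.Binary.BagAndSetEquality using (∼bag⇒↭)
open import Data.List.Relation.Binary.Permutation.Propositional using (_↭_; ↭-sym; ↭⇒↭ₛ)
open import Data.List.Relation.Binary.Permutation.Propositional.Properties using (map⁺; ↭-length)
open import Data.List.Relation.Binary.Permutation.Setoid.Properties using (foldr-commMonoid)
open import Data.List.Relation.Unary.Unique.Propositional using (Unique)
import Data.List.Relation.Unary.Unique.Propositional.Properties as Unique
open import Data.Nat.ListAction using (sum)
open import Data.Nat.ListAction.Properties using (sum-++; sum-↭)
open import Data.Product using (_×_; _,_; proj₁; swap)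
open import Function using (_∘_)
open import Function.Bundles using (mk⇔)
open import Relation.Binary.PropositionalEquality
  using (refl; sym; trans; cong; subst; subst₂; setoid; module ≡-Reasoning)
open import Relation.Nullary using (yes; no)
open import Relation.Nullary.Decidable using (_×-dec_)

private variable A B : Set

pairSum : (A → A → ℕ) → List A → ℕ
pairSum h S = sum (map (λ p → sum (map (h p) S)) S)

sum-concatMap : (f : A → List ℕ) (xs : List A) →
                sum (concatMap f xs) ≡ sum (map (sum ∘ f) xs)
sum-concatMap f []       = refl
sum-concatMap f (x ∷ xs) =
  trans (sum-++ (f x) (concatMap f xs)) (cong (λ s → sum (f x) + s) (sum-concatMap f xs))

pairSum-↭ : (h : A → A → ℕ) {S S' : List A} → S ↭ S' → pairSum h S ≡ pairSum h S'
pairSum-↭ h {S} {S'} σ = trans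
  (cong sum (map-cong (λ p → sum-↭ (map⁺ (h p) σ)) S))
  (sum-↭ (map⁺ (λ p → sum (map (h p) S')) σ))

pairSum-cong : {h h' : A → A → ℕ} → (∀ p q → h p q ≡ h' p q) → (S : List A) → pairSum h S ≡ pairSum h' S
pairSum-cong h≡h' S = cong sum (map-cong (λ p → cong sum (map-cong (h≡h' p) S)) S)

pairSum-map : (h : A → A → ℕ) (f : B → A) (S : List B) →
              pairSum h (map f S) ≡ pairSum (λ p q → h (f p) (f q)) S
pairSum-map h f S = trans (cong sum (sym (map-∘ S)))
  (cong sum (map-cong (λ p → cong sum (sym (map-∘ S))) S))

sumℤ-↭ : ∀ {xs ys : List ℤ} → xs ↭ ys → foldr _+ℤ_ (+ 0) xs ≡ foldr _+ℤ_ (+ 0) ys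
sumℤ-↭ σ = foldr-commMonoid (setoid ℤ) ℤ.+-0-isCommutativeMonoid (↭⇒↭ₛ σ)

map-bijection-↭ : ∀ {f g : A → A} {xs : List A} →
             (∀ x → f (g x) ≡ x) → (∀ x → g (f x) ≡ x) →
             Unique xs → (∀ x → x ∈ xs) → map g xs ↭ xs
map-bijection-↭ {f = f} {g} {xs} fg gf xs! xs-complete = ∼bag⇒↭ (unique∧set⇒bag
  (Unique.map⁺ g-injective xs!) xs!
  (λ {x} → mk⇔ (λ _ → xs-complete x) (λ _ → subst (_∈ map g xs) (gf x) (∈-map⁺ g (xs-complete (f x))))))
  where
  g-injective : ∀ {x y} → g x ≡ g y → x ≡ y
  g-injective {x} {y} gx≡gy = trans (sym (fg x)) (trans (cong f gx≡gy) (fg y))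

module _ {n : ℕ} (𝔽 : GF2^ n) where
  open GF2^ 𝔽
  open IsCommutativeRing isCommutativeRing using (+-comm)

  -- The summand of diffCount lives in its where-block; recover it by unification.
  -- It does not use S, so diffSummand S a b and diffSummand S' a b are convertible.
  diffSummand : List (K × K) → K → K → K × K → K × K → ℕ
  diffSummand S a b =
    proj₁ {B = λ h → diffCount 𝔽 S a b ≡ sum (concatMap (λ p → map (h p) S) S)} (_ , refl)

  diffCount-pairSum : ∀ S a b → diffCount 𝔽 S a b ≡ pairSum (diffSummand S a b) S
  diffCount-pairSum S a b = sum-concatMap (λ p → map (diffSummand S a b p) S) S

  diffSummand-swap : ∀ S a b x y x' y' →
    diffSummand S a b (y , x) (y' , x') ≡ diffSummand S b a (x , y) (x' , y')
  diffSummand-swap S a b x y x' y'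
    with ((y +F (-F y')) ≟ a) ×-dec ((x +F (-F x')) ≟ b)
       | ((x +F (-F x')) ≟ b) ×-dec ((y +F (-F y')) ≟ a)
  ... | yes _       | yes _       = refl
  ... | no _        | no _        = refl
  ... | yes (u , v) | no ¬vu      = ⊥-elim (¬vu (v , u))
  ... | no ¬uv      | yes (u , v) = ⊥-elim (¬uv (v , u))

  diffCount-↭ : ∀ {S S'} a b → S ↭ S' → diffCount 𝔽 S a b ≡ diffCount 𝔽 S' a b
  diffCount-↭ {S} {S'} a b σ = begin
    diffCount 𝔽 S a b                  ≡⟨ diffCount-pairSum S a b ⟩
    pairSum (diffSummand S a b) S      ≡⟨ pairSum-↭ (diffSummand S a b) σ ⟩
    pairSum (diffSummand S' a b) S'    ≡⟨ sym (diffCount-pairSum S' a b) ⟩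
    diffCount 𝔽 S' a b                 ∎
    where open ≡-Reasoning

  diffCount-swap : ∀ S a b → diffCount 𝔽 (map swap S) a b ≡ diffCount 𝔽 S b a
  diffCount-swap S a b = begin
    diffCount 𝔽 (map swap S) a b                         ≡⟨ diffCount-pairSum (map swap S) a b ⟩
    pairSum (diffSummand S a b) (map swap S)              ≡⟨ pairSum-map (diffSummand S a b) swap S ⟩
    pairSum (λ p q → diffSummand S a b (swap p) (swap q)) S
      ≡⟨ pairSum-cong {h' = diffSummand S b a} (λ { (x , y) (x' , y') → diffSummand-swap S a b x y x' y' }) S ⟩
    pairSum (diffSummand S b a) S                         ≡⟨ sym (diffCount-pairSum S b a) ⟩
    diffCount 𝔽 S b a                                     ∎
    where open ≡-Reasoning

  charSum-↭ : ∀ {S S'} a b → S ↭ S' → charSum 𝔽 S a b ≡ charSum 𝔽 S' a b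
  charSum-↭ a b σ = sumℤ-↭ (map⁺ _ σ)

  charSum-swap : ∀ S a b → charSum 𝔽 (map swap S) a b ≡ charSum 𝔽 S b a
  charSum-swap S a b = cong (foldr _+ℤ_ (+ 0)) (trans (sym (map-∘ S))
    (map-cong (λ { (x , y) → cong (sgn 𝔽) (+-comm (a *F y) (b *F x)) }) S))

  FormallySelfDual-↭ : ∀ {S S'} → S ↭ S' → FormallySelfDual 𝔽 S → FormallySelfDual 𝔽 S'
  FormallySelfDual-↭ σ S-dual a b
    rewrite sym (charSum-↭ a b σ) | sym (diffCount-↭ a b σ) | sym (↭-length σ) = S-dual a b

  FormallySelfDual-swap : ∀ S → FormallySelfDual 𝔽 S → FormallySelfDual 𝔽 (map swap S)
  FormallySelfDual-swap S S-dual a b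
    rewrite charSum-swap S a b | diffCount-swap S a b | length-map swap S = S-dual b a

  graph-inverse-↭ : ∀ {F Finv : K → K} → (∀ x → F (Finv x) ≡ x) → (∀ x → Finv (F x) ≡ x) →
                    graph 𝔽 Finv ↭ map swap (graph 𝔽 F)
  graph-inverse-↭ {F} {Finv} FFinv FinvF = subst₂ _↭_
    (trans (sym (map-∘ elements)) (map-cong (λ x → cong (_, Finv x) (FFinv x)) elements))
    (map-∘ elements)
    (map⁺ (λ y → F y , y) (map-bijection-↭ FFinv FinvF unique complete))

corollary6p17 : (n : ℕ) (𝔽 : GF2^ n) (F Finv : GF2^.K 𝔽 → GF2^.K 𝔽) →
    (∀ x → F (Finv x) ≡ x) → (∀ x → Finv (F x) ≡ x) →
    FormallySelfDual 𝔽 (graph 𝔽 F) → FormallySelfDual 𝔽 (graph 𝔽 Finv)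
corollary6p17 n 𝔽 F Finv FFinv FinvF F-dual =
  FormallySelfDual-↭ 𝔽 (↭-sym (graph-inverse-↭ 𝔽 FFinv FinvF)) (FormallySelfDual-swap 𝔽 (graph 𝔽 F) F-dual)
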